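{- Let $m$ be a positive integer, let $\ell=3\cdot 2^m-4$, and let $P_\ell$ denote the path of length $\ell$ (i.e., on $\ell+1$ vertices). Then $P_\ell\in\mathrm{TM}_{2m+1}^m$, but for every integer $d$ we have $P_{\ell+1}\notin\mathrm{TM}_d^m$.
   Context: All graphs are finite, simple and undirected. A tree-model of $m$ colours and depth $d$ of a graph $G$ is a rooted tree $T$ with a set $S\subseteq\{1,\dots,m\}^2\times\{1,\dots,d\}$ such that: every root-to-leaf path of $T$ has length exactly $d$; the leaves of $T$ are exactly $V(G)$; each leaf gets one of the colours $1,\dots,m$; $(i,j,\ell)\in S$ iff $(j,i,\ell)\in S$; and for distinct $u,v\in V(G)$ coloured $i,j$ at distance $2\ell$ in $T$, $uv\in E(G)$ iff $(i,j,\ell)\in S$. $\mathrm{TM}_d^m$ is the class of graphs having such a tree-model. -}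

module Defs where

open import Data.Nat using (ℕ; zero; suc; _+_; _*_; _∸_; _^_; _≤_)
open import Data.Nat.Properties using (1+n≢n)
open import Data.Fin using (Fin; toℕ)
open import Data.Bool using (Bool; true)
open import Data.Sum using (_⊎_; inj₁; inj₂; [_,_])
open import Data.Product using (Σ; _×_; ∃; ∃-syntax)
open import Relation.Binary.PropositionalEquality using (_≡_; _≢_; sym)
open import Relation.Nullary using (¬_)
open import Function.Bundles using (_⇔_)

record Graph : Set₁ where
  field
    n       : ℕ
    Adj     : Fin n → Fin n → Set
    irrefl  : ∀ u → ¬ Adj u u
    symm    : ∀ u v → Adj u v → Adj v u
open Graph public

pathAdj : (ℓ : ℕ) → Fin (suc ℓ) → Fin (suc ℓ) → Set
pathAdj ℓ i j = (toℕ j ≡ suc (toℕ i)) ⊎ (toℕ i ≡ suc (toℕ j))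

P : ℕ → Graph
P ℓ = record
  { n      = suc ℓ
  ; Adj    = pathAdj ℓ
  ; irrefl = λ u → [ (λ e → 1+n≢n (sym e)) , (λ e → 1+n≢n (sym e)) ]
  ; symm   = λ u v → [ inj₂ , inj₁ ]
  }

-- Rooted trees in which every root-to-leaf path has length exactly d,
-- with leaves labelled by elements of A.  An internal node has
-- (suc k) ≥ 1 children, indexed by Fin (suc k).
data Tree (A : Set) : ℕ → Set where
  leaf : A → Tree A zero
  node : ∀ {d} (k : ℕ) → (Fin (suc k) → Tree A d) → Tree A (suc d)

-- a occurs as (the label of) a leaf of t; a proof is a position of that leaf.
data _∈ᴸ_ {A : Set} (a : A) : ∀ {d} → Tree A d → Set where
  here  : a ∈ᴸ leaf a
  under : ∀ {d k} {f : Fin (suc k) → Tree A d} (i : Fin (suc k)) →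
          a ∈ᴸ f i → a ∈ᴸ node k f

-- Lca t a b h : the leaves a and b have their lowest common ancestor at
-- height h above the leaves, i.e. they are at distance 2h in t.
data Lca {A : Set} : ∀ {d} → Tree A d → A → A → ℕ → Set where
  split : ∀ {d k} {f : Fin (suc k) → Tree A d} {a b} (i j : Fin (suc k)) →
          i ≢ j → a ∈ᴸ f i → b ∈ᴸ f j → Lca (node k f) a b (suc d)
  down  : ∀ {d k} {f : Fin (suc k) → Tree A d} {a b h} (i : Fin (suc k)) →
          Lca (f i) a b h → Lca (node k f) a b h

-- S (i , j , ℓ) is encoded as the Boolean S i j ℓ (only ℓ ∈ {1,…,d} is ever used).
record TreeModel (m d : ℕ) (G : Graph) : Set where
  field
    T       : Tree (Fin (n G)) d
    leafPos : ∀ v → v ∈ᴸ T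
    leafUnq : ∀ v (p : v ∈ᴸ T) → p ≡ leafPos v
    col     : Fin (n G) → Fin m
    S       : Fin m → Fin m → ℕ → Bool
    S-sym   : ∀ i j ℓ → S i j ℓ ≡ S j i ℓ
    edges   : ∀ u v ℓ → u ≢ v → Lca T u v ℓ →
              (Adj G u v ⇔ (S (col u) (col v) ℓ ≡ true))

_∈TM[_,_] : Graph → ℕ → ℕ → Set
G ∈TM[ d , m ] = TreeModel m d G

-- A tree-model, read on the vertex numbers, is an UltraColouring:
-- lca heights form an ultrametric dist, and adjacency to y depends only on the
-- colour of a vertex and its dist to y.  In an interval [lo, hi) of the path,
-- split the vertices by whether they lie below the top-level lca together with
-- lo; across this split every dist is the same, so if x — y is an edge across
-- it, no other vertex on x's side away from y has the colour of x (exclusion).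
-- Starting at the first change of side, the runs of the two sides are scanned
-- (PathBound.Interval.Tail), removing the colours used up at each change; by
-- induction on the number n of colours an interval has at most size n vertices,
-- where size (n + 1) = 2 size n + 3.
--
-- The tree Z k is built recursively from two copies of level k,
-- the second one reflected, separated by three vertices of the new colour k,
-- the middle one hanging off the root; "stub" leaves at the ends of a copy stand
-- for its neighbours in the next level.  An explicit edge Rule on colours and
-- lca heights reproduces the path exactly (correct).

module Submission where

open import Defs
open import Data.Nat
open import Data.Nat.Properties
open import Data.Nat.Induction using (<-wellFounded)
open import Data.Nat.Tactic.RingSolver using (solve-∀)
open import Induction.WellFounded using (Acc; acc)
open import Data.Bool using (Bool; true; false; T)
open import Data.Bool.Properties using (¬-not)
open import Data.Fin using (Fin; zero; suc; toℕ; fromℕ<)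
open import Data.Fin.Properties using (toℕ-fromℕ<; toℕ<n; toℕ-injective) renaming (_≟_ to _≟ᶠ_)
open import Data.Fin.Subset using (Subset; _∈_; _-_) renaming (∣_∣ to card; ⊤ to everything)
open import Data.Fin.Subset.Properties using (_∈?_; ∣p─q∣≤∣p∣; x∈p⇒∣p-x∣<∣p∣; x∈p∧x∉q⇒x∈p─q; x≢y⇒x∉⁅y⁆; ∈⊤; ∣⊤∣≡n)
open import Data.Sum using (_⊎_; inj₁; inj₂)
open import Data.Product using (∃; ∃₂; _×_; _,_; proj₁; proj₂)
open import Data.Empty using (⊥-elim)
open import Relation.Nullary using (¬_; Dec; yes; no; does)
open import Relation.Nullary.Decidable using (_×-dec_; _⊎-dec_; ¬?; does-⇔)
open import Relation.Binary.PropositionalEquality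
open import Function.Bundles using (_⇔_; mk⇔; Equivalence)
open import Function.Construct.Composition using (_⇔-∘_)
open import Function.Construct.Symmetry using (⇔-sym)

-- size n = 3 · 2ⁿ - 3, the largest number of vertices of a path that has a
-- tree-model with n colours.
size : ℕ → ℕ
size zero    = 0
size (suc n) = size n + size n + 3

size-mono : ∀ {m n} → m ≤ n → size m ≤ size n
size-mono z≤n       = z≤n
size-mono (s≤s m≤n) = +-monoˡ-≤ 3 (+-mono-≤ (size-mono m≤n) (size-mono m≤n))

size-step : ∀ {m n} → m < n → size m + size m + 3 ≤ size n
size-step (s≤s m≤n) = size-mono (s≤s m≤n)

size-gap : ∀ {m n} → m < n → 2 + size m ≤ size n
size-gap {m} m<n = ≤-trans (≤-reflexive (+-comm 2 (size m)))
  (≤-trans (+-mono-≤ (m≤m+n (size m) (size m)) (n≤1+n 2)) (size-step m<n))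

size-closed : ∀ n → size n + 3 ≡ 3 * 2 ^ n
size-closed zero    = refl
size-closed (suc n) = begin
  size n + size n + 3 + 3     ≡⟨ double (size n) ⟩
  (size n + 3) + (size n + 3) ≡⟨ cong (λ x → x + x) (size-closed n) ⟩
  3 * 2 ^ n + 3 * 2 ^ n       ≡⟨ triple (2 ^ n) ⟩
  3 * 2 ^ suc n               ∎
  where
  open ≡-Reasoning
  double : ∀ x → x + x + 3 + 3 ≡ (x + 3) + (x + 3)
  double = solve-∀
  triple : ∀ y → 3 * y + 3 * y ≡ 3 * (2 * y)
  triple = solve-∀

-- tailBound b α β bounds the number of vertices after a change of side, when
-- the two sides beyond it use α and β colours (see PathBound.Interval.Tail):
-- in the strict case b = false one gets the finer bound max (size α + 1, size β).
tailBound : Bool → ℕ → ℕ → ℕ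
tailBound false α β = suc (size α) ⊔ size β
tailBound true  α β = 2 + size (α ⊔ β)

tailBound-weaken : ∀ b α β → tailBound false α β ≤ tailBound b α β
tailBound-weaken false α β = ≤-refl
tailBound-weaken true  α β = ⊔-lub
  (s≤s (≤-trans (size-mono (m≤m⊔n α β)) (n≤1+n _)))
  (≤-trans (size-mono (m≤n⊔m α β)) (m≤n+m _ 2))

run-to-end : ∀ b α β → suc (size α) ≤ tailBound b α β
run-to-end b α β = ≤-trans (m≤m⊔n (suc (size α)) (size β)) (tailBound-weaken b α β)

-- After a one-vertex run whose successor's colour is removed.
singleton-step : ∀ {α' α β} → α' < β → suc (tailBound false α' α) ≤ tailBound false α β
singleton-step {α'} {α} {β} α'<β =
  ⊔-lub {tailBound false α β} {suc (suc (size α'))} {suc (size α)} (≤-trans (size-gap α'<β) (m≤n⊔m (suc (size α)) (size β))) (m≤m⊔n (suc (size α)) (size β))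

-- After a one-vertex run whose successor repeats a removed colour.
singleton-repeat : ∀ α β → suc (tailBound false β α) ≤ tailBound true α β
singleton-repeat α β = ⊔-lub {tailBound true α β} {suc (suc (size β))} {suc (size α)}
  (s≤s (s≤s (size-mono (m≤n⊔m α β))))
  (s≤s (≤-trans (size-mono (m≤m⊔n α β)) (n≤1+n _)))

-- After a longer run, with one colour removed on each side.
long-step : ∀ {α' α β' β} → α' < α → β' < β →
            2 + size α' + tailBound true β' α' ≤ tailBound false α β
long-step {α'} {α} {β'} {β} α'<α β'<β with ≤-<-connex β' α'
... | inj₁ β'≤α' = begin
  2 + size α' + (2 + size (β' ⊔ α')) ≡⟨ cong (λ x → 2 + size α' + (2 + size x)) (m≤n⇒m⊔n≡n β'≤α') ⟩
  2 + size α' + (2 + size α')         ≡⟨ shuffle (size α') ⟩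
  suc (size α' + size α' + 3)         ≤⟨ s≤s (size-step α'<α) ⟩
  suc (size α)                        ≤⟨ m≤m⊔n (suc (size α)) (size β) ⟩
  tailBound false α β                 ∎
  where
  open ≤-Reasoning
  shuffle : ∀ a → 2 + a + (2 + a) ≡ suc (a + a + 3)
  shuffle = solve-∀
... | inj₂ α'<β' = begin
  2 + size α' + (2 + size (β' ⊔ α')) ≡⟨ cong (λ x → 2 + size α' + (2 + size x)) (m≥n⇒m⊔n≡m (<⇒≤ α'<β')) ⟩
  2 + size α' + (2 + size β')         ≡⟨ shuffle (size α') (size β') ⟩
  suc (size α') + size β' + 3         ≤⟨ +-monoˡ-≤ 3 (+-monoˡ-≤ (size β') α'≺β') ⟩
  size β' + size β' + 3               ≤⟨ size-step β'<β ⟩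
  size β                              ≤⟨ m≤n⊔m (suc (size α)) (size β) ⟩
  tailBound false α β                 ∎
  where
  open ≤-Reasoning
  shuffle : ∀ a b → 2 + a + (2 + b) ≡ suc a + b + 3
  shuffle = solve-∀
  α'≺β' : suc (size α') ≤ size β'
  α'≺β' = ≤-trans (n≤1+n _) (size-gap α'<β')

-- The arithmetic of the split at the first change of side: size s = 2 size (s - 1) + 3.
first-boundary : ∀ {e α β s} → e < s → α < s → β < s → size e + suc (tailBound true α β) ≤ size s
first-boundary {e} {α} {β} {suc s} (s≤s e≤s) (s≤s α≤s) (s≤s β≤s) = begin
  size e + (3 + size (α ⊔ β)) ≤⟨ +-mono-≤ (size-mono e≤s) (+-monoʳ-≤ 3 (size-mono (⊔-lub α≤s β≤s))) ⟩
  size s + (3 + size s)       ≡⟨ shuffle (size s) ⟩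
  size s + size s + 3         ∎
  where
  open ≤-Reasoning
  shuffle : ∀ a → a + (3 + a) ≡ a + a + 3
  shuffle = solve-∀

private
  variable
    A B : Set
    d k : ℕ
    a b e : A

lcaHeight : {t : Tree A d} → a ∈ᴸ t → b ∈ᴸ t → ℕ
lcaHeight here here = 0
lcaHeight {d = suc d} (under i p) (under j q) with i ≟ᶠ j
... | yes refl = lcaHeight p q
... | no _     = suc d

module _ {f : Fin (suc k) → Tree A d} where

  lcaHeight-same : ∀ i (p : a ∈ᴸ f i) (q : b ∈ᴸ f i) →
                   lcaHeight {t = node k f} (under i p) (under i q) ≡ lcaHeight p q
  lcaHeight-same i p q with i ≟ᶠ i
  ... | yes refl = refl
  ... | no i≢i   = ⊥-elim (i≢i refl)

  lcaHeight-apart : ∀ {i j} (p : a ∈ᴸ f i) (q : b ∈ᴸ f j) → i ≢ j →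
                    lcaHeight {t = node k f} (under i p) (under j q) ≡ suc d
  lcaHeight-apart {i = i} {j} p q i≢j with i ≟ᶠ j
  ... | yes i≡j = ⊥-elim (i≢j i≡j)
  ... | no _    = refl

lcaHeight-self : {t : Tree A d} (p : a ∈ᴸ t) → lcaHeight p p ≡ 0
lcaHeight-self here        = refl
lcaHeight-self (under i p) = trans (lcaHeight-same i p p) (lcaHeight-self p)

lcaHeight-sym : {t : Tree A d} (p : a ∈ᴸ t) (q : b ∈ᴸ t) → lcaHeight p q ≡ lcaHeight q p
lcaHeight-sym here        here        = refl
lcaHeight-sym (under i p) (under j q) = by-cases (i ≟ᶠ j)
  where
  by-cases : Dec (i ≡ j) → lcaHeight (under i p) (under j q) ≡ lcaHeight (under j q) (under i p)
  by-cases (yes refl) = trans (lcaHeight-same i p q) (trans (lcaHeight-sym p q) (sym (lcaHeight-same i q p)))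
  by-cases (no i≢j)   = trans (lcaHeight-apart p q i≢j) (sym (lcaHeight-apart q p (λ j≡i → i≢j (sym j≡i))))

lcaHeight-≤ : {t : Tree A d} (p : a ∈ᴸ t) (q : b ∈ᴸ t) → lcaHeight p q ≤ d
lcaHeight-≤ here here = z≤n
lcaHeight-≤ (under i p) (under j q) with i ≟ᶠ j
... | yes refl = ≤-trans (lcaHeight-≤ p q) (n≤1+n _)
... | no _     = ≤-refl

lcaHeight-ultra : {t : Tree A d} (p : a ∈ᴸ t) (q : b ∈ᴸ t) (r : e ∈ᴸ t) →
                  lcaHeight p r ≤ lcaHeight p q ⊔ lcaHeight q r
lcaHeight-ultra here here here = z≤n
lcaHeight-ultra {d = suc d} (under i p) (under j q) (under l r) = by-cases (i ≟ᶠ j) (j ≟ᶠ l)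
  where
  open ≤-Reasoning
  by-cases : Dec (i ≡ j) → Dec (j ≡ l) →
             lcaHeight (under i p) (under l r) ≤ lcaHeight (under i p) (under j q) ⊔ lcaHeight (under j q) (under l r)
  by-cases (yes refl) (yes refl) = begin
    lcaHeight (under i p) (under i r)                                     ≡⟨ lcaHeight-same i p r ⟩
    lcaHeight p r                                                        ≤⟨ lcaHeight-ultra p q r ⟩
    lcaHeight p q ⊔ lcaHeight q r                                        ≡⟨ sym (cong₂ _⊔_ (lcaHeight-same i p q) (lcaHeight-same i q r)) ⟩
    lcaHeight (under i p) (under i q) ⊔ lcaHeight (under i q) (under i r) ∎
  by-cases (yes refl) (no j≢l) = begin
    lcaHeight (under i p) (under l r)                                     ≤⟨ lcaHeight-≤ (under i p) (under l r) ⟩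
    suc d                                                                ≡⟨ sym (lcaHeight-apart q r j≢l) ⟩
    lcaHeight (under i q) (under l r)                                     ≤⟨ m≤n⊔m _ _ ⟩
    lcaHeight (under i p) (under i q) ⊔ lcaHeight (under i q) (under l r) ∎
  by-cases (no i≢j) _ = begin
    lcaHeight (under i p) (under l r)                                     ≤⟨ lcaHeight-≤ (under i p) (under l r) ⟩
    suc d                                                                ≡⟨ sym (lcaHeight-apart p q i≢j) ⟩
    lcaHeight (under i p) (under j q)                                     ≤⟨ m≤m⊔n _ _ ⟩
    lcaHeight (under i p) (under j q) ⊔ lcaHeight (under j q) (under l r) ∎

lcaHeight-Lca : {t : Tree A d} (p : a ∈ᴸ t) (q : b ∈ᴸ t) → a ≢ b → Lca t a b (lcaHeight p q)
lcaHeight-Lca here here a≢b = ⊥-elim (a≢b refl)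
lcaHeight-Lca (under i p) (under j q) a≢b with i ≟ᶠ j
... | yes refl = down i (lcaHeight-Lca p q a≢b)
... | no i≢j   = split i j i≢j p q

lcaHeight-pos : {t : Tree A d} (p : a ∈ᴸ t) (q : b ∈ᴸ t) → a ≢ b → 1 ≤ lcaHeight p q
lcaHeight-pos here here a≢b = ⊥-elim (a≢b refl)
lcaHeight-pos (under i p) (under j q) a≢b with i ≟ᶠ j
... | yes refl = lcaHeight-pos p q a≢b
... | no _     = s≤s z≤n

Lca-members : {t : Tree A d} → Lca t a b k → a ∈ᴸ t × b ∈ᴸ t
Lca-members (split i j _ p q) = under i p , under j q
Lca-members (down i l) with Lca-members l
... | p , q = under i p , under i q

chain : ∀ d → A → Tree A d
chain zero    a = leaf a
chain (suc d) a = node 0 (λ _ → chain d a)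

chain-pos : ∀ d (a : A) → a ∈ᴸ chain d a
chain-pos zero    a = here
chain-pos (suc d) a = under zero (chain-pos d a)

chain-member : ∀ d → b ∈ᴸ chain d a → b ≡ a
chain-member zero    here        = refl
chain-member (suc d) (under _ p) = chain-member d p

chain-no-Lca : ∀ d → ¬ Lca (chain d a) b e k
chain-no-Lca (suc d) (split zero zero 0≢0 _ _) = 0≢0 refl
chain-no-Lca (suc d) (down zero l)             = chain-no-Lca d l

two : Tree A d → Tree A d → Tree A (suc d)
two t₁ t₂ = node 1 λ { zero → t₁ ; (suc _) → t₂ }

mapT : (A → B) → Tree A d → Tree B d
mapT φ (leaf a)   = leaf (φ a)
mapT φ (node k f) = node k (λ i → mapT φ (f i))

mapT-pos : (φ : A → B) {t : Tree A d} → a ∈ᴸ t → φ a ∈ᴸ mapT φ t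
mapT-pos φ here        = here
mapT-pos φ (under i p) = under i (mapT-pos φ p)

mapT-preimage : (φ : A → B) {t : Tree A d} {b : B} → b ∈ᴸ mapT φ t → ∃ λ a → a ∈ᴸ t × φ a ≡ b
mapT-preimage φ {leaf a}   here        = a , here , refl
mapT-preimage φ {node k f} (under i p) with mapT-preimage φ {f i} p
... | a , q , φa≡b = a , under i q , φa≡b

mapT-Lca : (φ : A → B) {t : Tree A d} {b b' : B} → Lca (mapT φ t) b b' k →
           ∃₂ λ a a' → Lca t a a' k × φ a ≡ b × φ a' ≡ b'
mapT-Lca φ {node k f} (split i j i≢j p q) with mapT-preimage φ {f i} p | mapT-preimage φ {f j} q
... | a , p' , φa≡ | a' , q' , φa'≡ = a , a' , split i j i≢j p' q' , φa≡ , φa'≡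
mapT-Lca φ {node k f} (down i l) with mapT-Lca φ {f i} l
... | a , a' , l' , φa≡ , φa'≡ = a , a' , down i l' , φa≡ , φa'≡

Unique : Tree A d → Set
Unique t = ∀ a (p q : a ∈ᴸ t) → p ≡ q

chain-unique : ∀ d (a : A) → Unique (chain d a)
chain-unique zero    a .a here        here        = refl
chain-unique (suc d) a b  (under zero p) (under zero q) = cong (under zero) (chain-unique d a b p q)

two-unique : {t₁ t₂ : Tree A d} → Unique t₁ → Unique t₂ → (∀ a → a ∈ᴸ t₁ → ¬ a ∈ᴸ t₂) → Unique (two t₁ t₂)
two-unique u₁ u₂ disjoint a (under zero p)       (under zero q)       = cong (under zero) (u₁ a p q)
two-unique u₁ u₂ disjoint a (under (suc zero) p) (under (suc zero) q) = cong (under (suc zero)) (u₂ a p q)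
two-unique u₁ u₂ disjoint a (under zero p)       (under (suc zero) q) = ⊥-elim (disjoint a p q)
two-unique u₁ u₂ disjoint a (under (suc zero) p) (under zero q)       = ⊥-elim (disjoint a q p)

under-injective : {f : Fin (suc k) → Tree A d} {i j : Fin (suc k)} {p : a ∈ᴸ f i} {q : a ∈ᴸ f j} →
                  under {f = f} i p ≡ under j q → i ≡ j
under-injective refl = refl

mapT-unique : (φ : A → B) (t : Tree A d) → Unique t →
              (∀ {a a'} → a ∈ᴸ t → a' ∈ᴸ t → φ a ≡ φ a' → a ≡ a') → Unique (mapT φ t)
mapT-unique φ (leaf a)   u inj b here here = refl
mapT-unique φ (node k f) u inj b (under i p) (under j q) with i ≟ᶠ j
... | yes refl = cong (under i) (mapT-unique φ (f i) (λ a p' q' → under-injective-pos (u a (under i p') (under i q')))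
                   (λ pa pa' → inj (under i pa) (under i pa')) b p q)
  where
  under-injective-pos : ∀ {a} {p' q' : a ∈ᴸ f i} → under {f = f} i p' ≡ under i q' → p' ≡ q'
  under-injective-pos refl = refl
... | no i≢j with mapT-preimage φ {f i} p | mapT-preimage φ {f j} q
...   | a , pa , φa≡b | a' , pa' , φa'≡b with inj (under i pa) (under j pa') (trans φa≡b (sym φa'≡b))
...     | refl = ⊥-elim (i≢j (under-injective (u a (under i pa) (under j pa'))))

Adjacent : ℕ → ℕ → Set
Adjacent x y = (y ≡ suc x) ⊎ (x ≡ suc y)

nonadjacent : ∀ {z y} → suc z < y ⊎ suc y < z → ¬ Adjacent z y
nonadjacent (inj₁ z+1<y) (inj₁ refl) = <-irrefl refl z+1<y
nonadjacent (inj₁ z+1<y) (inj₂ refl) = <⇒≱ z+1<y (≤-trans (n≤1+n _) (n≤1+n _))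
nonadjacent (inj₂ y+1<z) (inj₁ refl) = <⇒≱ y+1<z (≤-trans (n≤1+n _) (n≤1+n _))
nonadjacent (inj₂ y+1<z) (inj₂ refl) = <-irrefl refl y+1<z

∈-remove : ∀ {m} {x y : Fin m} {p : Subset m} → x ∈ p → x ≢ y → x ∈ p - y
∈-remove x∈p x≢y = x∈p∧x∉q⇒x∈p─q x∈p (x≢y⇒x∉⁅y⁆ x≢y)

maxBelow : (ℕ → ℕ) → ℕ → ℕ
maxBelow g zero    = 0
maxBelow g (suc k) = maxBelow g k ⊔ g k

maxBelow-upper : ∀ g {i k} → i < k → g i ≤ maxBelow g k
maxBelow-upper g {i} {suc k} i<1+k with m≤n⇒m<n∨m≡n (≤-pred i<1+k)
... | inj₁ i<k  = ≤-trans (maxBelow-upper g i<k) (m≤m⊔n _ _)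
... | inj₂ refl = m≤n⊔m _ _

maxBelow-attained : ∀ g k → ∃ λ i → i < suc k × g i ≡ maxBelow g (suc k)
maxBelow-attained g zero = 0 , s≤s z≤n , refl
maxBelow-attained g (suc k) with ≤-total (maxBelow g (suc k)) (g (suc k))
... | inj₁ below = suc k , ≤-refl , sym (m≤n⇒m⊔n≡n below)
... | inj₂ above with maxBelow-attained g k
...   | i , i<1+k , gi≡ = i , ≤-trans i<1+k (n≤1+n _) , trans gi≡ (sym (m≥n⇒m⊔n≡m above))

runScan : (Q : ℕ → Bool) (u k : ℕ) →
         (∀ z → u ≤ z → z ≤ u + k → Q z ≡ Q u) ⊎
         ∃ λ v → u ≤ v × v < u + k × (∀ z → u ≤ z → z ≤ v → Q z ≡ Q u) × Q (suc v) ≢ Q u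
runScan Q u zero = inj₁ λ z u≤z z≤u+0 → cong Q (≤-antisym (≤-trans z≤u+0 (≤-reflexive (+-identityʳ u))) u≤z)
runScan Q u (suc k) with runScan Q u k
... | inj₂ (v , u≤v , v<u+k , run , turn) =
  inj₂ (v , u≤v , ≤-trans v<u+k (+-monoʳ-≤ u (n≤1+n k)) , run , turn)
... | inj₁ run with Q (suc (u + k)) Data.Bool.≟ Q u
...   | no turn = inj₂ (u + k , m≤m+n u k , ≤-reflexive (sym (+-suc u k)) , run , turn)
...   | yes same = inj₁ extended
  where
  extended : ∀ z → u ≤ z → z ≤ u + suc k → Q z ≡ Q u
  extended z u≤z z≤ with m≤n⇒m<n∨m≡n (≤-trans z≤ (≤-reflexive (+-suc u k)))
  ... | inj₁ z<1+u+k = run z u≤z (≤-pred z<1+u+k)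
  ... | inj₂ refl    = same

runEnd : (Q : ℕ → Bool) {u hi : ℕ} → u < hi →
         (∀ z → u ≤ z → z < hi → Q z ≡ Q u) ⊎
         ∃ λ v → u ≤ v × suc v < hi × (∀ z → u ≤ z → z ≤ v → Q z ≡ Q u) × Q (suc v) ≢ Q u
runEnd Q {u} {hi} u<hi with runScan Q u (hi ∸ suc u)
... | inj₁ run = inj₁ λ z u≤z z<hi → run z u≤z (≤-pred (subst (z <_) (sym (m+[n∸m]≡n u<hi)) z<hi))
... | inj₂ (v , u≤v , v<end , run , turn) =
  inj₂ (v , u≤v , subst (suc v <_) (m+[n∸m]≡n u<hi) (s≤s v<end) , run , turn)

∸-peel : ∀ {u hi} → u < hi → hi ∸ u ≡ suc (hi ∸ suc u)
∸-peel {zero}  {suc hi} _         = refl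
∸-peel {suc u} {suc hi} (s≤s u<hi) = ∸-peel u<hi

∸-split : ∀ {u v hi} → u ≤ v → v ≤ hi → hi ∸ u ≡ (v ∸ u) + (hi ∸ v)
∸-split {zero}  {v}     {hi}     _         v≤hi      = sym (m+[n∸m]≡n v≤hi)
∸-split {suc u} {suc v} {suc hi} (s≤s u≤v) (s≤s v≤hi) = ∸-split u≤v v≤hi

other-side : ∀ {a b c : Bool} → a ≢ b → c ≢ b → c ≡ a
other-side a≢b c≢b = trans (¬-not c≢b) (sym (¬-not a≢b))

-- What a tree-model of a path on V vertices with m colours provides, read on the
-- vertex numbers: a colouring, the lca-height "dist" (an ultrametric), and the
-- tree-model rule that whether y is adjacent to a vertex depends only on that
-- vertex's colour and its dist to y.
record UltraColouring (m V : ℕ) : Set where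
  field
    colour     : ℕ → Fin m
    dist       : ℕ → ℕ → ℕ
    dist-self  : ∀ x → dist x x ≡ 0
    dist-sym   : ∀ x y → dist x y ≡ dist y x
    dist-pos   : ∀ x y → x < V → y < V → x ≢ y → 1 ≤ dist x y
    dist-ultra : ∀ x y z → dist x z ≤ dist x y ⊔ dist y z
    transfer   : ∀ x y z → x < V → y < V → z < V → Adjacent x y →
                 colour z ≡ colour x → dist z y ≡ dist x y → z ≢ y → Adjacent z y

module PathBound {m V : ℕ} (U : UltraColouring m V) where
  open UltraColouring U

  ColoursIn : Subset m → ℕ → ℕ → Set
  ColoursIn E lo hi = ∀ x → lo ≤ x → x < hi → colour x ∈ E

  IntervalBound : ℕ → Set
  IntervalBound k = ∀ E lo hi → card E ≤ k → hi ≤ V → ColoursIn E lo hi → hi ∸ lo ≤ size (card E)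

  -- The top-level split of an interval [lo, hi) with at least two vertices:
  -- top is the largest dist from lo, and side x says whether x lies strictly
  -- below the top-level lca (together with lo) or not.
  module Interval (lo hi : ℕ) (hi≤V : hi ≤ V) (lo+1<hi : suc lo < hi) where

    In : ℕ → Set
    In x = lo ≤ x × x < hi

    <V : ∀ {x} → In x → x < V
    <V (_ , x<hi) = ≤-trans x<hi hi≤V

    lo<hi : lo < hi
    lo<hi = ≤-trans (n≤1+n _) lo+1<hi

    top : ℕ
    top = maxBelow (λ i → dist lo (lo + i)) (hi ∸ lo)

    top-upper : ∀ {x} → In x → dist lo x ≤ top
    top-upper {x} (lo≤x , x<hi) = subst (λ y → dist lo y ≤ top) (m+[n∸m]≡n lo≤x)
      (maxBelow-upper (λ i → dist lo (lo + i)) (∸-monoˡ-< x<hi lo≤x))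

    top-attained : ∃ λ x → In x × dist lo x ≡ top
    top-attained with maxBelow-attained (λ i → dist lo (lo + i)) (pred (hi ∸ lo))
    ... | i , i<len , attained = lo + i , (m≤m+n lo i , i<hi) , trans attained (cong (maxBelow _) len≡)
      where
      len≡ : suc (pred (hi ∸ lo)) ≡ hi ∸ lo
      len≡ = suc-pred (hi ∸ lo) {{>-nonZero (m<n⇒0<n∸m lo<hi)}}
      i<hi : lo + i < hi
      i<hi = subst (lo + i <_) (m+[n∸m]≡n (<⇒≤ lo<hi))
               (+-monoʳ-< lo (subst (i <_) len≡ i<len))

    top-pos : 1 ≤ top
    top-pos = ≤-trans (dist-pos lo (suc lo) (<V (≤-refl , lo<hi)) (<V (n≤1+n lo , lo+1<hi)) (λ e → 1+n≢n (sym e)))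
                      (top-upper (n≤1+n lo , lo+1<hi))

    side : ℕ → Bool
    side x = dist lo x <ᵇ top

    below-top : ∀ {x} → side x ≡ true → dist lo x < top
    below-top {x} s = <ᵇ⇒< (dist lo x) top (subst T (sym s) _)

    at-top : ∀ {x} → In x → side x ≡ false → dist lo x ≡ top
    at-top {x} x∈ s = ≤-antisym (top-upper x∈) (≮⇒≥ λ x<top → subst T s (<⇒<ᵇ x<top))

    side-lo : side lo ≡ true
    side-lo with side lo in s
    ... | true  = refl
    ... | false = ⊥-elim (<⇒≱ top-pos (≤-reflexive (trans (sym (at-top (≤-refl , lo<hi) s)) (dist-self lo))))

    far : ∃ λ x → In x × side x ≡ false
    far with top-attained
    ... | x , x∈ , dx≡top with side x in s
    ...   | false = x , x∈ , s
    ...   | true  = ⊥-elim (<-irrefl dx≡top (below-top s))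

    near-far : ∀ {x y} → side x ≡ true → In y → side y ≡ false → dist x y ≡ top
    near-far {x} {y} sx y∈ sy = ≤-antisym
      (≤-trans (dist-ultra x lo y) (⊔-lub (≤-trans (≤-reflexive (dist-sym x lo)) (<⇒≤ (below-top sx))) (≤-reflexive dy)))
      (≮⇒≥ λ dxy<top → <⇒≱ (⊔-lub (below-top sx) dxy<top) (≤-trans (≤-reflexive (sym dy)) (dist-ultra lo x y)))
      where
      dy : dist lo y ≡ top
      dy = at-top y∈ sy

    cross-dist : ∀ {x y} → In x → In y → side x ≢ side y → dist x y ≡ top
    cross-dist {x} {y} x∈ y∈ x≁y with side x in sx | side y in sy
    ... | true  | false = near-far sx y∈ sy
    ... | false | true  = trans (dist-sym x y) (near-far sy x∈ sx)
    ... | true  | true  = ⊥-elim (x≁y refl)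
    ... | false | false = ⊥-elim (x≁y refl)

    In-after : ∀ {w z} → lo ≤ w → w < z → z < hi → In z
    In-after lo≤w w<z z<hi = ≤-trans lo≤w (<⇒≤ w<z) , z<hi

    -- If x — y is an edge across the top-level split, every vertex z on x's
    -- side with the colour of x is adjacent to y as well (it sees y at the same
    -- height); so a vertex on x's side that is not adjacent to y has another colour.
    exclusion : ∀ {x y z} → In x → In y → In z → side x ≢ side y → Adjacent x y →
                side z ≡ side x → ¬ Adjacent z y → colour z ≢ colour x
    exclusion {x} {y} {z} x∈ y∈ z∈ apart xy zx ¬zy same =
      ¬zy (transfer x y z (<V x∈) (<V y∈) (<V z∈) xy same dists z≢y)
      where
      dists : dist z y ≡ dist x y
      dists = trans (cross-dist z∈ y∈ (λ e → apart (trans (sym zx) e))) (sym (cross-dist x∈ y∈ apart))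
      z≢y : z ≢ y
      z≢y refl = apart (sym zx)

    avoid : ∀ {E x y z} → In x → In y → In z → side x ≢ side y → Adjacent x y →
            side z ≡ side x → ¬ Adjacent z y → colour z ∈ E → colour z ∈ E - colour x
    avoid x∈ y∈ z∈ apart xy zx ¬zy c∈E = ∈-remove c∈E (exclusion x∈ y∈ z∈ apart xy zx ¬zy)

    -- Bounding the part of the interval after a boundary w | w + 1 between the
    -- two sides, given the bound for at most k colours.
    module Tail (k : ℕ) (IH : IntervalBound k) where

      record Hyp (b : Bool) (w : ℕ) (Eo Et : Subset m) : Set where
        field
          lo≤w   : lo ≤ w
          w+1<hi : suc w < hi
          turn   : side (suc w) ≢ side w
          own    : ∀ z → suc w < z → z < hi → side z ≡ side (suc w) → colour z ∈ Eo
          other  : ∀ z → suc (suc w) < z → z < hi → side z ≡ side w → colour z ∈ Et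
          strict : b ≡ false → suc (suc w) < hi → side (suc (suc w)) ≡ side w → colour (suc (suc w)) ∈ Et
          Eo≤k   : card Eo ≤ k
          Et≤k   : card Et ≤ k

        w+1∈ : In (suc w)
        w+1∈ = ≤-trans lo≤w (n≤1+n w) , w+1<hi

        back : ∀ {z} → side z ≢ side (suc w) → side z ≡ side w
        back = other-side (λ e → turn (sym e))

      Claim : ℕ → Set
      Claim w = ∀ b Eo Et → Hyp b w Eo Et → hi ∸ suc w ≤ tailBound b (card Eo) (card Et)

      -- The run starting at w + 1 reaches hi: the rest is one interval of colours in Eo.
      to-end : ∀ b {w Eo Et} → Hyp b w Eo Et → (∀ z → suc w ≤ z → z < hi → side z ≡ side (suc w)) →
               hi ∸ suc w ≤ tailBound b (card Eo) (card Et)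
      to-end b {w} {Eo} {Et} h run = begin
        hi ∸ suc w                       ≡⟨ ∸-peel w+1<hi ⟩
        suc (hi ∸ suc (suc w))           ≤⟨ s≤s (IH Eo (suc (suc w)) hi Eo≤k hi≤V rest) ⟩
        suc (size (card Eo))             ≤⟨ run-to-end b (card Eo) (card Et) ⟩
        tailBound b (card Eo) (card Et)  ∎
        where
        open Hyp h
        open ≤-Reasoning
        rest : ColoursIn Eo (suc (suc w)) hi
        rest z w+2≤z z<hi = own z w+2≤z z<hi (run z (≤-trans (n≤1+n _) w+2≤z) z<hi)

      singleton-hyp : ∀ {b w Eo Et} → Hyp b w Eo Et → suc (suc w) < hi → side (suc (suc w)) ≢ side (suc w) →
                      ∀ E' → (∀ z → suc (suc w) < z → z < hi → side z ≡ side w → colour z ∈ E') → card E' ≤ k →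
                      Hyp false (suc w) E' Eo
      singleton-hyp {w = w} h w+2<hi turn₂ E' after E'≤k = record
        { lo≤w   = ≤-trans lo≤w (n≤1+n w)
        ; w+1<hi = w+2<hi
        ; turn   = turn₂
        ; own    = λ z w+2<z z<hi sz → after z w+2<z z<hi (trans sz (back turn₂))
        ; other  = λ z w+3<z z<hi sz → own z (<-trans (n<1+n _) (<-trans (n<1+n _) w+3<z)) z<hi sz
        ; strict = λ _ w+3<hi sz → own (suc (suc (suc w))) (<-trans (n<1+n _) (n<1+n _)) w+3<hi sz
        ; Eo≤k   = E'≤k
        ; Et≤k   = Eo≤k
        }
        where open Hyp h

      -- The run starting at w + 1 is the single vertex w + 1.  If the colour of
      -- w + 2 is new on its side it is removed; otherwise b = true.
      singleton : ∀ b {w Eo Et} → Hyp b w Eo Et → (∀ {v} → w < v → v < hi → Claim v) →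
                  suc (suc w) < hi → side (suc (suc w)) ≢ side (suc w) →
                  hi ∸ suc w ≤ tailBound b (card Eo) (card Et)
      singleton b {w} {Eo} {Et} h next w+2<hi turn₂ with colour (suc (suc w)) ∈? Et
      ... | yes c₂∈Et = begin
        hi ∸ suc w                                       ≡⟨ ∸-peel (Hyp.w+1<hi h) ⟩
        suc (hi ∸ suc (suc w))                           ≤⟨ s≤s (next (n<1+n w) (Hyp.w+1<hi h) false Et′ Eo hyp) ⟩
        suc (tailBound false (card Et′) (card Eo))       ≤⟨ singleton-step {α = card Eo} (x∈p⇒∣p-x∣<∣p∣ c₂∈Et) ⟩
        tailBound false (card Eo) (card Et)              ≤⟨ tailBound-weaken b (card Eo) (card Et) ⟩
        tailBound b (card Eo) (card Et)                  ∎
        where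
        open ≤-Reasoning
        open Hyp h
        Et′ : Subset m
        Et′ = Et - colour (suc (suc w))
        after : ∀ z → suc (suc w) < z → z < hi → side z ≡ side w → colour z ∈ Et′
        after z w+2<z z<hi sz = avoid (In-after lo≤w (<-trans (n<1+n w) (n<1+n _)) w+2<hi) w+1∈
          (In-after lo≤w (<-trans (<-trans (n<1+n _) (n<1+n _)) w+2<z) z<hi) turn₂ (inj₂ refl)
          (trans sz (sym (back turn₂))) (nonadjacent (inj₂ w+2<z)) (other z w+2<z z<hi sz)
        hyp : Hyp false (suc w) Et′ Eo
        hyp = singleton-hyp h w+2<hi turn₂ Et′ after (≤-trans (∣p─q∣≤∣p∣ Et _) Et≤k)
      ... | no c₂∉Et = repeated b (Hyp.strict h)
        where
        hyp : Hyp false (suc w) Et Eo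
        hyp = singleton-hyp h w+2<hi turn₂ Et (Hyp.other h) (Hyp.Et≤k h)
        rest : hi ∸ suc w ≤ suc (tailBound false (card Et) (card Eo))
        rest = ≤-trans (≤-reflexive (∸-peel (Hyp.w+1<hi h))) (s≤s (next (n<1+n w) (Hyp.w+1<hi h) false Et Eo hyp))
        repeated : ∀ b → (b ≡ false → suc (suc w) < hi → side (suc (suc w)) ≡ side w → colour (suc (suc w)) ∈ Et) →
                   hi ∸ suc w ≤ tailBound b (card Eo) (card Et)
        repeated true  _      = ≤-trans rest (singleton-repeat (card Eo) (card Et))
        repeated false strict = ⊥-elim (c₂∉Et (strict refl w+2<hi (Hyp.back h turn₂)))

      long-hyp : ∀ {b w Eo Et} → Hyp b w Eo Et → ∀ {v} → suc w < v → suc v < hi →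
                 side v ≡ side (suc w) → side (suc v) ≢ side (suc w) →
                 Hyp true v (Et - colour (suc v)) (Eo - colour v)
      long-hyp {w = w} {Eo} {Et} h {v} w+1<v v+1<hi sᵥ turnᵥ = record
        { lo≤w   = ≤-trans lo≤w (<⇒≤ w<v)
        ; w+1<hi = v+1<hi
        ; turn   = λ e → apart (sym e)
        ; own    = λ z v+1<z z<hi sz → avoid v+1∈ v∈ (In-after lo≤w (<-trans w<v (<-trans (n<1+n v) v+1<z)) z<hi)
            (λ e → apart (sym e)) (inj₂ refl) sz (nonadjacent (inj₂ v+1<z))
            (other z (<-trans (s≤s w+1<v) v+1<z) z<hi (trans sz (back turnᵥ)))
        ; other  = λ z v+2<z z<hi sz → avoid v∈ v+1∈ (In-after lo≤w (<-trans w<v (v<z v+2<z)) z<hi)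
            apart (inj₁ refl) sz (nonadjacent (inj₂ v+2<z))
            (own z (<-trans w+1<v (v<z v+2<z)) z<hi (trans sz sᵥ))
        ; strict = λ ()
        ; Eo≤k   = ≤-trans (∣p─q∣≤∣p∣ Et _) Et≤k
        ; Et≤k   = ≤-trans (∣p─q∣≤∣p∣ Eo _) Eo≤k
        }
        where
        open Hyp h
        w<v : w < v
        w<v = <-trans (n<1+n w) w+1<v
        v<z : ∀ {z} → suc (suc v) < z → v < z
        v<z v+2<z = <-trans (n<1+n v) (<-trans (n<1+n _) v+2<z)
        apart : side v ≢ side (suc v)
        apart e = turn (trans (sym sᵥ) (trans e (back turnᵥ)))
        v∈ : In v
        v∈ = In-after lo≤w w<v (<-trans (n<1+n v) v+1<hi)
        v+1∈ : In (suc v)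
        v+1∈ = In-after lo≤w (<-trans w<v (n<1+n v)) v+1<hi

      -- The run starting at w + 1 ends at some v > w + 1: the vertices strictly
      -- between w + 1 and v avoid the colour of v, and the bound continues at
      -- the boundary v | v + 1.
      long : ∀ b {w Eo Et} → Hyp b w Eo Et → (∀ {v} → w < v → v < hi → Claim v) →
             ∀ {v} → suc w < v → suc v < hi → (∀ z → suc w ≤ z → z ≤ v → side z ≡ side (suc w)) →
             side (suc v) ≢ side (suc w) → hi ∸ suc w ≤ tailBound b (card Eo) (card Et)
      long b {w} {Eo} {Et} h next {v} w+1<v v+1<hi run turnᵥ = begin
        hi ∸ suc w                                                 ≡⟨ ∸-split (s≤s (<⇒≤ w<v)) (<⇒≤ v+1<hi) ⟩
        (v ∸ w) + (hi ∸ suc v)                                     ≡⟨ cong (_+ (hi ∸ suc v)) (trans (∸-peel w<v) (cong suc (∸-peel w+1<v))) ⟩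
        2 + (v ∸ suc (suc w)) + (hi ∸ suc v)                       ≤⟨ +-mono-≤ (s≤s (s≤s middle)) rest ⟩
        2 + size (card Eo′) + tailBound true (card Et′) (card Eo′) ≤⟨ long-step (x∈p⇒∣p-x∣<∣p∣ cᵥ∈Eo) (x∈p⇒∣p-x∣<∣p∣ cᵥ₊₁∈Et) ⟩
        tailBound false (card Eo) (card Et)                        ≤⟨ tailBound-weaken b (card Eo) (card Et) ⟩
        tailBound b (card Eo) (card Et)                            ∎
        where
        open ≤-Reasoning
        open Hyp h
        Eo′ Et′ : Subset m
        Eo′ = Eo - colour v
        Et′ = Et - colour (suc v)
        w<v : w < v
        w<v = <-trans (n<1+n w) w+1<v
        v<hi : v < hi
        v<hi = <-trans (n<1+n v) v+1<hi
        sᵥ : side v ≡ side (suc w)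
        sᵥ = run v (<⇒≤ w+1<v) ≤-refl
        cᵥ∈Eo : colour v ∈ Eo
        cᵥ∈Eo = own v w+1<v v<hi sᵥ
        cᵥ₊₁∈Et : colour (suc v) ∈ Et
        cᵥ₊₁∈Et = other (suc v) (s≤s w+1<v) v+1<hi (back turnᵥ)
        middle : v ∸ suc (suc w) ≤ size (card Eo′)
        middle = IH Eo′ (suc (suc w)) v (≤-trans (∣p─q∣≤∣p∣ Eo _) Eo≤k) (≤-trans (<⇒≤ v<hi) hi≤V) cols
          where
          cols : ColoursIn Eo′ (suc (suc w)) v
          cols z w+1<z z<v = avoid (In-after lo≤w w<v v<hi) (In-after lo≤w (<-trans w<v (n<1+n v)) v+1<hi)
            (In-after lo≤w (<-trans (n<1+n w) w+1<z) (<-trans z<v v<hi))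
            (λ e → turnᵥ (trans (sym e) sᵥ)) (inj₁ refl) (trans sz (sym sᵥ)) (nonadjacent (inj₁ (s≤s z<v)))
            (own z w+1<z (<-trans z<v v<hi) sz)
            where
            sz : side z ≡ side (suc w)
            sz = run z (<⇒≤ w+1<z) (<⇒≤ z<v)
        rest : hi ∸ suc v ≤ tailBound true (card Et′) (card Eo′)
        rest = next w<v v<hi true Et′ Eo′ (long-hyp h w+1<v v+1<hi sᵥ turnᵥ)

      tail : ∀ w → Acc _<_ (hi ∸ w) → Claim w
      tail w (acc rec) b Eo Et h with runEnd side (Hyp.w+1<hi h)
      ... | inj₁ run = to-end b h run
      ... | inj₂ (v , w+1≤v , v+1<hi , run , turnᵥ) with m≤n⇒m<n∨m≡n w+1≤v
      ...   | inj₂ refl  = singleton b h (λ w<u u<hi → tail _ (rec (∸-monoʳ-< w<u (<⇒≤ u<hi)))) v+1<hi turnᵥ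
      ...   | inj₁ w+1<v = long b h (λ w<u u<hi → tail _ (rec (∸-monoʳ-< w<u (<⇒≤ u<hi)))) w+1<v v+1<hi run turnᵥ

    first-hyp : ∀ k (IH : IntervalBound k) E → card E ≤ suc k → ColoursIn E lo hi →
                ∀ {p} → lo ≤ p → suc p < hi → side p ≢ side (suc p) →
                Tail.Hyp k IH true p (E - colour (suc p)) (E - colour p)
    first-hyp k IH E E≤ cols {p} lo≤p p+1<hi apart = record
      { lo≤w   = lo≤p
      ; w+1<hi = p+1<hi
      ; turn   = λ e → apart (sym e)
      ; own    = λ z p+1<z z<hi sz → avoid p+1∈ p∈ (z∈ (<-trans (n<1+n p) p+1<z) z<hi) (λ e → apart (sym e)) (inj₂ refl)
          sz (nonadjacent (inj₂ p+1<z)) (cols z (proj₁ (z∈ (<-trans (n<1+n p) p+1<z) z<hi)) z<hi)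
      ; other  = λ z p+2<z z<hi sz → avoid p∈ p+1∈ (z∈ (p<z p+2<z) z<hi) apart (inj₁ refl)
          sz (nonadjacent (inj₂ p+2<z)) (cols z (proj₁ (z∈ (p<z p+2<z) z<hi)) z<hi)
      ; strict = λ ()
      ; Eo≤k   = ≤-pred (≤-trans (x∈p⇒∣p-x∣<∣p∣ (cols (suc p) (proj₁ p+1∈) p+1<hi)) E≤)
      ; Et≤k   = ≤-pred (≤-trans (x∈p⇒∣p-x∣<∣p∣ (cols p lo≤p (proj₂ p∈))) E≤)
      }
      where
      p∈ : In p
      p∈ = lo≤p , <-trans (n<1+n p) p+1<hi
      p+1∈ : In (suc p)
      p+1∈ = In-after lo≤p (n<1+n p) p+1<hi
      z∈ : ∀ {z} → p < z → z < hi → In z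
      z∈ = In-after lo≤p
      p<z : ∀ {z} → suc (suc p) < z → p < z
      p<z p+2<z = <-trans (n<1+n p) (<-trans (n<1+n _) p+2<z)

    -- The first change of side, at p | p + 1, splits [lo, hi) into [lo, p),
    -- which avoids the colour of p, the vertex p, and the tail after p.
    split-bound : ∀ k → IntervalBound k → ∀ E → card E ≤ suc k → ColoursIn E lo hi → hi ∸ lo ≤ size (card E)
    split-bound k IH E E≤ cols with runEnd side lo<hi
    ... | inj₁ constant with far
    ...   | x , (lo≤x , x<hi) , sx = ⊥-elim (true≢false (trans (sym side-lo) (trans (sym (constant x lo≤x x<hi)) sx)))
      where
      true≢false : true ≢ false
      true≢false ()
    split-bound k IH E E≤ cols | inj₂ (p , lo≤p , p+1<hi , run , turnₚ) = begin
      hi ∸ lo                                                   ≡⟨ ∸-split lo≤p (<⇒≤ p<hi) ⟩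
      (p ∸ lo) + (hi ∸ p)                                       ≡⟨ cong ((p ∸ lo) +_) (∸-peel p<hi) ⟩
      (p ∸ lo) + suc (hi ∸ suc p)                               ≤⟨ +-mono-≤ piece (s≤s rest) ⟩
      size (card Et) + suc (tailBound true (card Eo) (card Et)) ≤⟨ first-boundary Et<E Eo<E Et<E ⟩
      size (card E)                                             ∎
      where
      open ≤-Reasoning
      Eo Et : Subset m
      Eo = E - colour (suc p)
      Et = E - colour p
      p<hi : p < hi
      p<hi = <-trans (n<1+n p) p+1<hi
      apart : side p ≢ side (suc p)
      apart e = turnₚ (trans (sym e) (run p lo≤p ≤-refl))
      Eo<E : card Eo < card E
      Eo<E = x∈p⇒∣p-x∣<∣p∣ (cols (suc p) (≤-trans lo≤p (n≤1+n p)) p+1<hi)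
      Et<E : card Et < card E
      Et<E = x∈p⇒∣p-x∣<∣p∣ (cols p lo≤p p<hi)
      piece : p ∸ lo ≤ size (card Et)
      piece = IH Et lo p (≤-pred (≤-trans Et<E E≤)) (≤-trans (<⇒≤ p<hi) hi≤V) before
        where
        before : ColoursIn Et lo p
        before z lo≤z z<p = avoid (lo≤p , p<hi) (In-after lo≤p (n<1+n p) p+1<hi) (lo≤z , <-trans z<p p<hi) apart (inj₁ refl)
          (trans (run z lo≤z (<⇒≤ z<p)) (sym (run p lo≤p ≤-refl))) (nonadjacent (inj₁ (s≤s z<p)))
          (cols z lo≤z (<-trans z<p p<hi))
      rest : hi ∸ suc p ≤ tailBound true (card Eo) (card Et)
      rest = Tail.tail k IH p (<-wellFounded _) true Eo Et (first-hyp k IH E E≤ cols lo≤p p+1<hi apart)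

  interval-bound : ∀ k → IntervalBound k
  interval-bound zero E lo hi E≤0 hi≤V cols with lo <? hi
  ... | yes lo<hi = ⊥-elim (<⇒≱ (x∈p⇒∣p-x∣<∣p∣ (cols lo ≤-refl lo<hi)) (≤-trans E≤0 z≤n))
  ... | no  lo≮hi = ≤-trans (≤-reflexive (m≤n⇒m∸n≡0 (≮⇒≥ lo≮hi))) z≤n
  interval-bound (suc k) E lo hi E≤ hi≤V cols with suc lo <? hi
  ... | yes lo+1<hi = Interval.split-bound lo hi hi≤V lo+1<hi k (interval-bound k) E E≤ cols
  ... | no  short with lo <? hi
  ...   | no  lo≮hi = ≤-trans (≤-reflexive (m≤n⇒m∸n≡0 (≮⇒≥ lo≮hi))) z≤n
  ...   | yes lo<hi = begin
    hi ∸ lo       ≤⟨ ∸-monoˡ-≤ lo (≮⇒≥ short) ⟩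
    suc lo ∸ lo   ≡⟨ m+n∸n≡m 1 lo ⟩
    1             ≤⟨ s≤s z≤n ⟩
    size 1        ≤⟨ size-mono (≤-trans (s≤s z≤n) (x∈p⇒∣p-x∣<∣p∣ (cols lo ≤-refl lo<hi))) ⟩
    size (card E) ∎
    where open ≤-Reasoning

  path-bound : V ≤ size m
  path-bound = subst (λ s → V ≤ size s) (∣⊤∣≡n m)
    (interval-bound m everything 0 V (≤-reflexive (∣⊤∣≡n m)) ≤-refl (λ _ _ _ → ∈⊤))

adjacent-distinct : ∀ {x y} → Adjacent x y → x ≢ y
adjacent-distinct (inj₁ refl) e = 1+n≢n (sym e)
adjacent-distinct (inj₂ refl) e = 1+n≢n e

module FromTreeModel {m d N : ℕ} (M : TreeModel m d (P N)) where
  open TreeModel M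

  -- The vertex with number x (clamped to the vertex set).
  vertex : ℕ → Fin (suc N)
  vertex x = fromℕ< (s≤s (m⊓n≤n x N))

  toℕ-vertex : ∀ {x} → x < suc N → toℕ (vertex x) ≡ x
  toℕ-vertex {x} (s≤s x≤N) = trans (toℕ-fromℕ< (s≤s (m⊓n≤n x N))) (m≤n⇒m⊓n≡m x≤N)

  adjacent⇒Adj : ∀ {x y} → x < suc N → y < suc N → Adjacent x y → Adj (P N) (vertex x) (vertex y)
  adjacent⇒Adj x< y< = subst₂ Adjacent (sym (toℕ-vertex x<)) (sym (toℕ-vertex y<))

  Adj⇒adjacent : ∀ {x y} → x < suc N → y < suc N → Adj (P N) (vertex x) (vertex y) → Adjacent x y
  Adj⇒adjacent x< y< = subst₂ Adjacent (toℕ-vertex x<) (toℕ-vertex y<)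

  distinct : ∀ {x y} → x < suc N → y < suc N → x ≢ y → vertex x ≢ vertex y
  distinct x< y< x≢y e = x≢y (trans (sym (toℕ-vertex x<)) (trans (cong toℕ e) (toℕ-vertex y<)))

  dist : ℕ → ℕ → ℕ
  dist x y = lcaHeight (leafPos (vertex x)) (leafPos (vertex y))

  edge-rule : ∀ {x y} → x < suc N → y < suc N → x ≢ y →
              Adj (P N) (vertex x) (vertex y) ⇔ (S (col (vertex x)) (col (vertex y)) (dist x y) ≡ true)
  edge-rule x< y< x≢y = edges _ _ _ (distinct x< y< x≢y)
    (lcaHeight-Lca (leafPos _) (leafPos _) (distinct x< y< x≢y))

  ultraColouring : UltraColouring m (suc N)
  ultraColouring = record
    { colour     = λ x → col (vertex x)
    ; dist       = dist
    ; dist-self  = λ x → lcaHeight-self (leafPos (vertex x))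
    ; dist-sym   = λ x y → lcaHeight-sym (leafPos (vertex x)) (leafPos (vertex y))
    ; dist-pos   = λ x y x< y< x≢y → lcaHeight-pos (leafPos _) (leafPos _) (distinct x< y< x≢y)
    ; dist-ultra = λ x y z → lcaHeight-ultra (leafPos (vertex x)) (leafPos (vertex y)) (leafPos (vertex z))
    ; transfer   = transfer
    }
    where
    transfer : ∀ x y z → x < suc N → y < suc N → z < suc N → Adjacent x y →
               col (vertex z) ≡ col (vertex x) → dist z y ≡ dist x y → z ≢ y → Adjacent z y
    transfer x y z x< y< z< xy same-colour same-dist z≢y = Adj⇒adjacent z< y< (Equivalence.from (edge-rule z< y< z≢y)
      (subst₂ (λ c h → S c (col (vertex y)) h ≡ true) (sym same-colour) (sym same-dist)
        (Equivalence.to (edge-rule x< y< (adjacent-distinct xy)) (adjacent⇒Adj x< y< xy))))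

vertex-count : ∀ m → 1 ≤ m → suc (3 * 2 ^ m ∸ 4) ≡ size m
vertex-count m 1≤m = begin
  suc (3 * 2 ^ m ∸ 4)      ≡⟨ cong (λ t → suc (t ∸ 4)) (sym (size-closed m)) ⟩
  suc (size m + 3 ∸ 4)     ≡⟨ drop3 (size-mono 1≤m) ⟩
  size m                   ∎
  where
  open ≡-Reasoning
  drop3 : ∀ {s} → 3 ≤ s → suc (s + 3 ∸ 4) ≡ s
  drop3 {suc s} _ = cong suc (m+n∸n≡m s 3)

no-tree-model : ∀ m → 1 ≤ m → (d : ℕ) → ¬ TreeModel m d (P (suc (3 * 2 ^ m ∸ 4)))
no-tree-model m 1≤m d M = 1+n≰n (subst (λ n → suc n ≤ size m) (vertex-count m 1≤m)
  (PathBound.path-bound (FromTreeModel.ultraColouring M)))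

height : ℕ → ℕ
height zero    = 1
height (suc k) = suc (suc (height k))

height≢0 : ∀ k → height k ≢ 0
height≢0 zero    ()
height≢0 (suc k) ()

height-odd : ∀ k a → height k ≢ suc (height a)
height-odd zero    zero    ()
height-odd zero    (suc a) ()
height-odd (suc k) zero    e = height≢0 k (suc-injective (suc-injective e))
height-odd (suc k) (suc a) e = height-odd k a (suc-injective (suc-injective e))

-- The edge rule: at height 1 (only a stub and its neighbour) the colours must
-- differ, and at height height (suc a) = 2a + 3 exactly the pairs of colour a
-- are adjacent.
Rule : ℕ → ℕ → ℕ → Set
Rule a b ℓ = (ℓ ≡ 1 × a ≢ b) ⊎ (a ≡ b × ℓ ≡ height (suc a))

rule? : ∀ a b ℓ → Dec (Rule a b ℓ)
rule? a b ℓ = ((ℓ ≟ 1) ×-dec ¬? (a ≟ b)) ⊎-dec ((a ≟ b) ×-dec (ℓ ≟ height (suc a)))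

Rule-sym : ∀ {a b ℓ} → Rule a b ℓ → Rule b a ℓ
Rule-sym (inj₁ (ℓ≡1 , a≢b)) = inj₁ (ℓ≡1 , λ b≡a → a≢b (sym b≡a))
Rule-sym (inj₂ (refl , ℓ≡)) = inj₂ (refl , ℓ≡)

-- At the even height of the split between the two copies nothing is adjacent.
Rule-even : ∀ {a b} k → ¬ Rule a b (suc (height k))
Rule-even k (inj₁ (ℓ≡1 , _)) = height≢0 k (suc-injective ℓ≡1)
Rule-even k (inj₂ (_ , ℓ≡))  = height-odd k _ (suc-injective ℓ≡)

Rule-top : ∀ {a} k → Rule a k (height (suc k)) ⇔ a ≡ k
Rule-top k = mk⇔ to λ { refl → inj₂ (refl , refl) }
  where
  to : ∀ {a} → Rule a k (height (suc k)) → a ≡ k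
  to (inj₁ (() , _))
  to (inj₂ (a≡k , _)) = a≡k

reflect-adjacent : ∀ {n q q'} → q ≤ n → q' ≤ n → Adjacent q q' → Adjacent (n ∸ q) (n ∸ q')
reflect-adjacent q≤n q'≤n (inj₁ refl) = inj₂ (∸-peel q'≤n)
reflect-adjacent q≤n q'≤n (inj₂ refl) = inj₁ (∸-peel q≤n)

reflect-adjacent⇔ : ∀ {n q q'} → q ≤ n → q' ≤ n → Adjacent (n ∸ q) (n ∸ q') ⇔ Adjacent q q'
reflect-adjacent⇔ {n} {q} {q'} q≤n q'≤n = mk⇔
  (λ adj → subst₂ Adjacent (m∸[m∸n]≡n q≤n) (m∸[m∸n]≡n q'≤n) (reflect-adjacent (m∸n≤m n q) (m∸n≤m n q') adj))
  (reflect-adjacent q≤n q'≤n)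

-- Positions at level k: 0 is the start stub, 1 … size k are the path
-- vertices, suc (size k) is the end stub.  At level suc k the left copy of
-- level k keeps its positions, the middle vertex sits at mid k, and the right
-- copy is reflected by mirror k onto mid k + 1 … suc (size (suc k)).
mid : ℕ → ℕ
mid k = suc (suc (size k))

mirror : ℕ → ℕ → ℕ
mirror k q = suc (size (suc k)) ∸ q

last≤ : ∀ k → suc (size k) ≤ suc (size (suc k))
last≤ k = s≤s (≤-trans (m≤m+n (size k) (size k)) (m≤m+n _ 3))

mirror-involutive : ∀ k {q} → q ≤ suc (size (suc k)) → mirror k (mirror k q) ≡ q
mirror-involutive k = m∸[m∸n]≡n

mirror-≤ : ∀ k q → mirror k q ≤ suc (size (suc k))
mirror-≤ k q = m∸n≤m _ q

mirror-last : ∀ k → mirror k (suc (size k)) ≡ suc (mid k)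
mirror-last k = begin
  size (suc k) ∸ size k              ≡⟨ cong (_∸ size k) (+-assoc (size k) (size k) 3) ⟩
  size k + (size k + 3) ∸ size k     ≡⟨ m+n∸m≡n (size k) (size k + 3) ⟩
  size k + 3                         ≡⟨ +-comm (size k) 3 ⟩
  suc (mid k)                        ∎
  where open ≡-Reasoning

mirror-right : ∀ k {q} → q ≤ suc (size k) → suc (mid k) ≤ mirror k q
mirror-right k q≤ = ≤-trans (≤-reflexive (sym (mirror-last k))) (∸-monoʳ-≤ (suc (size (suc k))) q≤)

mirror-left : ∀ k {a} → suc (mid k) ≤ a → mirror k a ≤ suc (size k)
mirror-left k {a} mid<a = begin
  mirror k a                          ≤⟨ ∸-monoʳ-≤ (suc (size (suc k))) mid<a ⟩
  mirror k (suc (mid k))              ≡⟨ cong (mirror k) (sym (mirror-last k)) ⟩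
  mirror k (mirror k (suc (size k)))  ≡⟨ mirror-involutive k (last≤ k) ⟩
  suc (size k)                        ∎
  where open ≤-Reasoning

mirror-mid : ∀ k → mirror k (mid k) ≡ mid k
mirror-mid k = begin
  size (suc k) ∸ suc (size k)               ≡⟨ cong (_∸ suc (size k)) (shuffle (size k)) ⟩
  suc (size k) + suc (suc (size k)) ∸ suc (size k) ≡⟨ m+n∸m≡n (suc (size k)) (mid k) ⟩
  mid k                                      ∎
  where
  open ≡-Reasoning
  shuffle : ∀ a → a + a + 3 ≡ suc a + suc (suc a)
  shuffle = solve-∀

-- The tree at level 0: the end stub 1, together with the start stub 0 if hs.
stub : Bool → Tree ℕ 1
stub true  = two (leaf 1) (leaf 0)
stub false = chain 1 1

-- Z k hs he: a tree of depth 2k + 1 whose leaves are the path vertices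
-- 1 … size k, the start stub 0 if hs, and the end stub suc (size k) if he
-- (at level 0 the end stub is always present).
Z      : (k : ℕ) → Bool → Bool → Tree ℕ (height k)
Halves : (k : ℕ) → Bool → Bool → Tree ℕ (suc (height k))
Z zero    hs he = stub hs
Z (suc k) hs he = two (Halves k hs he) (chain (suc (height k)) (mid k))

Halves k hs he = two (Z k hs true) (mapT (mirror k) (Z k he true))

size-grows : ∀ k → suc (suc (size k)) ≤ size (suc k)
size-grows k = ≤-trans (≤-reflexive (+-comm 2 (size k))) (+-mono-≤ (m≤m+n (size k) (size k)) (n≤1+n 2))

range : ∀ k {hs he a} → a ∈ᴸ Z k hs he → a ≤ suc (size k)
range zero    {true}  (under zero here)       = ≤-refl
range zero    {true}  (under (suc zero) here) = z≤n
range zero    {false} p                      = ≤-reflexive (chain-member 1 p)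
range (suc k) (under zero (under zero p))    = ≤-trans (range k p) (last≤ k)
range (suc k) (under zero (under (suc zero) p)) with mapT-preimage (mirror k) p
... | q , _ , refl = mirror-≤ k q
range (suc k) (under (suc zero) p) rewrite chain-member (suc (height k)) p = s≤s (≤-trans (n≤1+n _) (size-grows k))

halves-range : ∀ k {hs he a} → a ∈ᴸ Halves k hs he → a ≤ suc (size k) ⊎ suc (mid k) ≤ a
halves-range k (under zero p) = inj₁ (range k p)
halves-range k (under (suc zero) p) with mapT-preimage (mirror k) p
... | q , q∈ , refl = inj₂ (mirror-right k (range k q∈))

no-start : ∀ k {he} → ¬ 0 ∈ᴸ Z k false he
no-start zero    p with chain-member 1 p
... | ()
no-start (suc k) (under zero (under zero p)) = no-start k p
no-start (suc k) (under zero (under (suc zero) p)) with mapT-preimage (mirror k) p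
... | q , q∈ , mq≡0 with ≤-trans (mirror-right k (range k q∈)) (≤-reflexive mq≡0)
...   | ()
no-start (suc k) (under (suc zero) p) with chain-member (suc (height k)) p
... | ()

no-end : ∀ k {hs} → ¬ suc (size (suc k)) ∈ᴸ Z (suc k) hs false
no-end k (under zero (under zero p)) = <⇒≱ (s≤s (≤-trans (n≤1+n _) (size-grows k))) (range k p)
no-end k (under zero (under (suc zero) p)) with mapT-preimage (mirror k) p
... | q , q∈ , mq≡ = no-start k (subst (_∈ᴸ Z k false true) q≡0 q∈)
  where
  q≡0 : q ≡ 0
  q≡0 = begin
    q                                  ≡⟨ sym (mirror-involutive k (≤-trans (range k q∈) (last≤ k))) ⟩
    mirror k (mirror k q)              ≡⟨ cong (mirror k) mq≡ ⟩
    mirror k (suc (size (suc k)))      ≡⟨ n∸n≡0 (suc (size (suc k))) ⟩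
    0                                  ∎
    where open ≡-Reasoning
no-end k (under (suc zero) p) = <-irrefl (sym (chain-member (suc (height k)) p)) (s≤s (size-grows k))

vertices-only : ∀ k {a} → a ∈ᴸ Z (suc k) false false → 1 ≤ a × a ≤ size (suc k)
vertices-only k {a} p =
  n≢0⇒n>0 (λ { refl → no-start (suc k) p }) ,
  ≤-pred (≤∧≢⇒< (range (suc k) p) (λ { refl → no-end k p }))

cover-start : ∀ k {he} → 0 ∈ᴸ Z k true he
cover-start zero    = under (suc zero) here
cover-start (suc k) = under zero (under zero (cover-start k))

cover-end : ∀ k {hs} → suc (size k) ∈ᴸ Z k hs true
cover-end zero    {true}  = under zero here
cover-end zero    {false} = chain-pos 1 1
cover-end (suc k)         = under zero (under (suc zero) (mapT-pos (mirror k) (cover-start k)))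

position-cases : ∀ k {a} → a ≤ suc (size (suc k)) → a ≤ suc (size k) ⊎ a ≡ mid k ⊎ suc (mid k) ≤ a
position-cases k {a} _ with a ≤? suc (size k)
... | yes a≤last = inj₁ a≤last
... | no  a≰last with a ≟ mid k
...   | yes a≡mid = inj₂ (inj₁ a≡mid)
...   | no  a≢mid = inj₂ (inj₂ (≤∧≢⇒< (≰⇒> a≰last) (λ e → a≢mid (sym e))))

cover : ∀ k {hs he a} → 1 ≤ a → a ≤ size k → a ∈ᴸ Z k hs he
cover-right : ∀ k {hs he a} → suc (mid k) ≤ a → a ≤ size (suc k) → a ∈ᴸ Z (suc k) hs he

cover zero    1≤a a≤0 = ⊥-elim (<⇒≱ 1≤a a≤0)
cover (suc k) 1≤a a≤ with position-cases k (≤-trans a≤ (n≤1+n _))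
... | inj₁ a≤last with m≤n⇒m<n∨m≡n a≤last
...   | inj₁ a<last = under zero (under zero (cover k 1≤a (≤-pred a<last)))
...   | inj₂ refl   = under zero (under zero (cover-end k))
cover (suc k) 1≤a a≤ | inj₂ (inj₁ refl)  = under (suc zero) (chain-pos (suc (height k)) (mid k))
cover (suc k) 1≤a a≤ | inj₂ (inj₂ mid<a) = cover-right k mid<a a≤

cover-right k {hs} {he} {a} mid<a a≤ = under zero (under (suc zero)
  (subst (_∈ᴸ mapT (mirror k) (Z k he true)) (mirror-involutive k (≤-trans a≤ (n≤1+n _))) (mapT-pos (mirror k) reflected)))
  where
  q≤ : mirror k a ≤ suc (size k)
  q≤ = mirror-left k mid<a
  reflected : mirror k a ∈ᴸ Z k he true
  reflected with m≤n⇒m<n∨m≡n q≤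
  ... | inj₁ q<last = cover k (m<n⇒0<n∸m (s≤s a≤)) (≤-pred q<last)
  ... | inj₂ q≡last = subst (_∈ᴸ Z k he true) (sym q≡last) (cover-end k)

-- Every label occurs at most once in Z k: the left copy, the right copy and
-- the middle vertex occupy disjoint ranges of positions.
unique : ∀ k {hs he} → Unique (Z k hs he)
unique zero    {true}  = two-unique (chain-unique 0 1) (chain-unique 0 0) λ { _ here () }
unique zero    {false} = chain-unique 1 1
unique (suc k) {hs} {he} = two-unique
  (two-unique (unique k) (mapT-unique (mirror k) (Z k he true) (unique k) reflection-injective) left∩right)
  (chain-unique (suc (height k)) (mid k)) halves∩middle
  where
  reflection-injective : ∀ {a a'} → a ∈ᴸ Z k he true → a' ∈ᴸ Z k he true → mirror k a ≡ mirror k a' → a ≡ a'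
  reflection-injective {a} {a'} a∈ a'∈ e = begin
    a                      ≡⟨ sym (mirror-involutive k (≤-trans (range k a∈) (last≤ k))) ⟩
    mirror k (mirror k a)  ≡⟨ cong (mirror k) e ⟩
    mirror k (mirror k a') ≡⟨ mirror-involutive k (≤-trans (range k a'∈) (last≤ k)) ⟩
    a'                     ∎
    where open ≡-Reasoning
  left∩right : ∀ a → a ∈ᴸ Z k hs true → ¬ a ∈ᴸ mapT (mirror k) (Z k he true)
  left∩right a a∈L a∈R with mapT-preimage (mirror k) a∈R
  ... | q , q∈ , refl = <⇒≱ (≤-trans (s≤s (s≤s (n≤1+n _))) (mirror-right k (range k q∈))) (range k a∈L)
  halves∩middle : ∀ a → a ∈ᴸ Halves k hs he → ¬ a ∈ᴸ chain (suc (height k)) (mid k)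
  halves∩middle a a∈ a∈M with chain-member (suc (height k)) a∈M | halves-range k a∈
  ... | refl | inj₁ mid≤last = 1+n≰n mid≤last
  ... | refl | inj₂ mid<mid  = 1+n≰n mid<mid

-- colour k c a: the colour of position a at level k, where the start stub
-- has colour c, and the middle vertex and both neighbouring stubs of level
-- suc k get the new colour k.
colour : ℕ → ℕ → ℕ → ℕ
colour zero    c zero    = c
colour zero    c (suc _) = 0
colour (suc k) c a with a ≤? suc (size k)
... | yes _ = colour k c a
... | no  _ with a ≟ mid k
...   | yes _ = k
...   | no  _ = colour k (suc k) (mirror k a)

colour-left : ∀ k c {a} → a ≤ suc (size k) → colour (suc k) c a ≡ colour k c a
colour-left k c {a} a≤ with a ≤? suc (size k)
... | yes _   = refl
... | no  a≰ = ⊥-elim (a≰ a≤)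

colour-mid : ∀ k c → colour (suc k) c (mid k) ≡ k
colour-mid k c with mid k ≤? suc (size k)
... | yes mid≤ = ⊥-elim (1+n≰n mid≤)
... | no  _ with mid k ≟ mid k
...   | yes _       = refl
...   | no  mid≢mid = ⊥-elim (mid≢mid refl)

colour-right : ∀ k c {q} → q ≤ suc (size k) → colour (suc k) c (mirror k q) ≡ colour k (suc k) q
colour-right k c {q} q≤ with mirror k q ≤? suc (size k)
... | yes m≤ = ⊥-elim (<⇒≱ (≤-trans (s≤s (s≤s (n≤1+n _))) (mirror-right k q≤)) m≤)
... | no  _ with mirror k q ≟ mid k
...   | yes m≡mid = ⊥-elim (<-irrefl (sym m≡mid) (mirror-right k q≤))
...   | no  _     = cong (colour k (suc k)) (mirror-involutive k (≤-trans q≤ (last≤ k)))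

colour-start : ∀ k c → colour k c 0 ≡ c
colour-start zero    c = refl
colour-start (suc k) c = trans (colour-left k c z≤n) (colour-start k c)

colour-end : ∀ k c → colour k c (suc (size k)) ≡ k
colour-end zero    c = refl
colour-end (suc k) c = trans (colour-right k c z≤n) (colour-start k (suc k))

colour-vertex : ∀ k c {a} → 1 ≤ a → a ≤ size k → colour k c a < k
colour-≤      : ∀ k c {a} → 1 ≤ a → a ≤ suc (size k) → colour k c a ≤ k

colour-≤ k c 1≤a a≤ with m≤n⇒m<n∨m≡n a≤
... | inj₁ a<last = <⇒≤ (colour-vertex k c 1≤a (≤-pred a<last))
... | inj₂ refl   = ≤-reflexive (colour-end k c)

colour-vertex zero    c 1≤a a≤0 = ⊥-elim (<⇒≱ 1≤a a≤0)
colour-vertex (suc k) c {a} 1≤a a≤ with position-cases k (≤-trans a≤ (n≤1+n _))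
... | inj₁ a≤last       = subst (_< suc k) (sym (colour-left k c a≤last)) (s≤s (colour-≤ k c 1≤a a≤last))
... | inj₂ (inj₁ refl)  = subst (_< suc k) (sym (colour-mid k c)) ≤-refl
... | inj₂ (inj₂ mid<a) = subst (_< suc k) (sym colour≡) (s≤s (colour-≤ k (suc k) (m<n⇒0<n∸m (s≤s a≤)) q≤))
  where
  q≤ : mirror k a ≤ suc (size k)
  q≤ = mirror-left k mid<a
  colour≡ : colour (suc k) c a ≡ colour k (suc k) (mirror k a)
  colour≡ = trans (cong (colour (suc k) c) (sym (mirror-involutive k (≤-trans a≤ (n≤1+n _))))) (colour-right k c q≤)

colour-is-k : ∀ k {c a} → k < c → a ≤ suc (size k) → colour k c a ≡ k ⇔ a ≡ suc (size k)
colour-is-k k {c} {a} k<c a≤ = mk⇔ (to a≤) λ { refl → colour-end k c }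
  where
  to : ∀ {a} → a ≤ suc (size k) → colour k c a ≡ k → a ≡ suc (size k)
  to {zero}  _  colour≡k = ⊥-elim (<-irrefl (trans (sym colour≡k) (colour-start k c)) k<c)
  to {suc a} a≤ colour≡k with m≤n⇒m<n∨m≡n a≤
  ... | inj₁ a<last = ⊥-elim (<-irrefl colour≡k (colour-vertex k c (s≤s z≤n) (≤-pred a<last)))
  ... | inj₂ a≡last = a≡last

Adjacent-sym : ∀ {a b} → Adjacent a b → Adjacent b a
Adjacent-sym (inj₁ e) = inj₂ e
Adjacent-sym (inj₂ e) = inj₁ e

swapped : ∀ {a b x y ℓ} → Adjacent b a ⇔ Rule y x ℓ → Adjacent a b ⇔ Rule x y ℓ
swapped ba⇔ = mk⇔ (λ ab → Rule-sym (Equivalence.to ba⇔ (Adjacent-sym ab)))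
                  (λ r → Adjacent-sym (Equivalence.from ba⇔ (Rule-sym r)))

next-to-mid : ∀ k {a} → a ≤ suc (size k) → Adjacent a (mid k) ⇔ a ≡ suc (size k)
next-to-mid k a≤ = mk⇔ to λ { refl → inj₁ refl }
  where
  to : Adjacent _ (mid k) → _ ≡ suc (size k)
  to (inj₁ mid≡) = sym (suc-injective mid≡)
  to (inj₂ refl) = ⊥-elim (1+n≰n (≤-trans (s≤s (n≤1+n _)) a≤))

next-to-mid-coloured : ∀ k {hs he c a} → suc k < c → a ∈ᴸ Halves k hs he → Adjacent a (mid k) ⇔ colour (suc k) c a ≡ k
next-to-mid-coloured k {c = c} {a} k+1<c (under zero p) =
  ⇔-sym (subst (λ x → x ≡ k ⇔ a ≡ suc (size k)) (sym (colour-left k c (range k p))) (colour-is-k k (<-trans (n<1+n k) k+1<c) (range k p)))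
  ⇔-∘ next-to-mid k (range k p)
next-to-mid-coloured k {c = c} k+1<c (under (suc zero) p) with mapT-preimage (mirror k) p
... | q , q∈ , refl =
  (⇔-sym (subst (λ x → x ≡ k ⇔ q ≡ suc (size k)) (sym (colour-right k c (range k q∈))) (colour-is-k k (n<1+n k) (range k q∈)))
   ⇔-∘ next-to-mid k (range k q∈))
  ⇔-∘ subst (λ x → Adjacent (mirror k q) x ⇔ Adjacent q (mid k)) (mirror-mid k)
          (reflect-adjacent⇔ (≤-trans (range k q∈) (last≤ k)) (≤-trans (n≤1+n _) (s≤s (size-grows k))))

top-split : ∀ k {hs he c a} → suc k < c → a ∈ᴸ Halves k hs he →
            Adjacent a (mid k) ⇔ Rule (colour (suc k) c a) (colour (suc k) c (mid k)) (height (suc k))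
top-split k {c = c} {a} k+1<c a∈ = subst (λ x → Adjacent a (mid k) ⇔ Rule (colour (suc k) c a) x (height (suc k)))
  (sym (colour-mid k c)) (⇔-sym (Rule-top k) ⇔-∘ next-to-mid-coloured k k+1<c a∈)

halves-split : ∀ k {hs he a b} → a ∈ᴸ Z k hs true → b ∈ᴸ mapT (mirror k) (Z k he true) →
               ∀ x y → Adjacent a b ⇔ Rule x y (suc (height k))
halves-split k a∈ b∈ x y with mapT-preimage (mirror k) b∈
... | q , q∈ , refl = mk⇔
  (λ adj → ⊥-elim (nonadjacent (inj₁ (≤-trans (s≤s (s≤s (range k a∈))) (mirror-right k (range k q∈)))) adj))
  (λ r → ⊥-elim (Rule-even k r))

correct : ∀ k {hs he c} → k < c → ∀ {a b ℓ} → Lca (Z k hs he) a b ℓ → Adjacent a b ⇔ Rule (colour k c a) (colour k c b) ℓ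
correct zero {true} 0<c (split zero (suc zero) _ here here) =
  mk⇔ (λ _ → inj₁ (refl , λ 0≡c → <-irrefl 0≡c 0<c)) (λ _ → inj₂ refl)
correct zero {true} 0<c (split (suc zero) zero _ here here) =
  mk⇔ (λ _ → inj₁ (refl , λ c≡0 → <-irrefl (sym c≡0) 0<c)) (λ _ → inj₁ refl)
correct zero {true}  _ (split zero zero 0≢0 _ _)             = ⊥-elim (0≢0 refl)
correct zero {true}  _ (split (suc zero) (suc zero) 1≢1 _ _) = ⊥-elim (1≢1 refl)
correct zero {true}  _ (down zero ())
correct zero {true}  _ (down (suc zero) ())
correct zero {false} _ l = ⊥-elim (chain-no-Lca 1 l)
correct (suc k) k<c (split zero (suc zero) _ a∈ b∈) with chain-member (suc (height k)) b∈
... | refl = top-split k k<c a∈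
correct (suc k) k<c (split (suc zero) zero _ a∈ b∈) with chain-member (suc (height k)) a∈
... | refl = swapped (top-split k k<c b∈)
correct (suc k) _ (split zero zero 0≢0 _ _)             = ⊥-elim (0≢0 refl)
correct (suc k) _ (split (suc zero) (suc zero) 1≢1 _ _) = ⊥-elim (1≢1 refl)
correct (suc k) _ (down (suc zero) l) = ⊥-elim (chain-no-Lca (suc (height k)) l)
correct (suc k) _ (down zero (split zero (suc zero) _ a∈ b∈)) = halves-split k a∈ b∈ _ _
correct (suc k) _ (down zero (split (suc zero) zero _ a∈ b∈)) = swapped (halves-split k b∈ a∈ _ _)
correct (suc k) _ (down zero (split zero zero 0≢0 _ _))             = ⊥-elim (0≢0 refl)
correct (suc k) _ (down zero (split (suc zero) (suc zero) 1≢1 _ _)) = ⊥-elim (1≢1 refl)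
correct (suc k) {c = c} k<c (down zero (down zero l)) with Lca-members l
... | a∈ , b∈ = subst₂ (λ x y → _ ⇔ Rule x y _) (sym (colour-left k c (range k a∈))) (sym (colour-left k c (range k b∈)))
                  (correct k (<-trans (n<1+n k) k<c) l)
correct (suc k) {c = c} k<c (down zero (down (suc zero) l)) with mapT-Lca (mirror k) l
... | a , b , l' , refl , refl with Lca-members l'
...   | a∈ , b∈ = subst₂ (λ x y → _ ⇔ Rule x y _) (sym (colour-right k c (range k a∈))) (sym (colour-right k c (range k b∈)))
                    (correct k (n<1+n k) l' ⇔-∘ reflect-adjacent⇔ (≤-trans (range k a∈) (last≤ k)) (≤-trans (range k b∈) (last≤ k)))

does≡true⇔ : ∀ {A : Set} (a? : Dec A) → (does a? ≡ true) ⇔ A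
does≡true⇔ (yes a) = mk⇔ (λ _ → a) (λ _ → refl)
does≡true⇔ (no ¬a) = mk⇔ (λ ()) (λ a → ⊥-elim (¬a a))

Adjacent-suc⇔ : ∀ {x y} → Adjacent (suc x) (suc y) ⇔ Adjacent x y
Adjacent-suc⇔ = mk⇔ (λ { (inj₁ e) → inj₁ (suc-injective e) ; (inj₂ e) → inj₂ (suc-injective e) })
                    (λ { (inj₁ e) → inj₁ (cong suc e) ; (inj₂ e) → inj₂ (cong suc e) })

-- The tree-model of the path P N with suc N = size (suc k): the leaves of
-- Z (suc k) false false are the positions 1 … size (suc k), and vertex v of
-- P N sits at position suc v.
module PathModel (k N : ℕ) (vertices : suc N ≡ size (suc k)) where

  m : ℕ
  m = suc k

  -- Position a ≥ 1 holds vertex a - 1 (clamped to the vertex set), and vertex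
  -- v sits at position suc v.
  vertex : ℕ → Fin (suc N)
  vertex a = fromℕ< (s≤s (m⊓n≤n (pred a) N))

  position : Fin (suc N) → ℕ
  position v = suc (toℕ v)

  position≤ : ∀ v → position v ≤ size m
  position≤ v = subst (position v ≤_) vertices (toℕ<n v)

  toℕ-vertex : ∀ {a} → 1 ≤ a → a ≤ size m → suc (toℕ (vertex a)) ≡ a
  toℕ-vertex {suc a} _ a<size = cong suc (trans (toℕ-fromℕ< _) (m≤n⇒m⊓n≡m (≤-pred (subst (suc a ≤_) (sym vertices) a<size))))

  vertex-position : ∀ v → vertex (position v) ≡ v
  vertex-position v = toℕ-injective (suc-injective (toℕ-vertex (s≤s z≤n) (position≤ v)))

  tree : Tree (Fin (suc N)) (height m)
  tree = mapT vertex (Z m false false)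

  leafPos : ∀ v → v ∈ᴸ tree
  leafPos v = subst (_∈ᴸ tree) (vertex-position v) (mapT-pos vertex (cover m (s≤s z≤n) (position≤ v)))

  leafUnq : ∀ v (p : v ∈ᴸ tree) → p ≡ leafPos v
  leafUnq v p = mapT-unique vertex (Z m false false) (unique m) vertex-injective v p (leafPos v)
    where
    vertex-injective : ∀ {a a'} → a ∈ᴸ Z m false false → a' ∈ᴸ Z m false false → vertex a ≡ vertex a' → a ≡ a'
    vertex-injective a∈ a'∈ e with vertices-only k a∈ | vertices-only k a'∈
    ... | 1≤a , a≤ | 1≤a' , a'≤ = trans (sym (toℕ-vertex 1≤a a≤)) (trans (cong (λ w → suc (toℕ w)) e) (toℕ-vertex 1≤a' a'≤))

  col : Fin (suc N) → Fin m
  col v = fromℕ< (colour-vertex m (suc m) (s≤s z≤n) (position≤ v))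

  S : Fin m → Fin m → ℕ → Bool
  S i j ℓ = does (rule? (toℕ i) (toℕ j) ℓ)

  S-sym : ∀ i j ℓ → S i j ℓ ≡ S j i ℓ
  S-sym i j ℓ = does-⇔ (mk⇔ Rule-sym Rule-sym) (rule? (toℕ i) (toℕ j) ℓ) (rule? (toℕ j) (toℕ i) ℓ)

  edges : ∀ u v ℓ → u ≢ v → Lca tree u v ℓ → (Adj (P N) u v ⇔ (S (col u) (col v) ℓ ≡ true))
  edges u v ℓ _ lca with mapT-Lca vertex lca
  ... | a , b , lca' , refl , refl with Lca-members lca'
  ...   | a∈ , b∈ with vertices-only k a∈ | vertices-only k b∈
  ...     | 1≤a , a≤ | 1≤b , b≤ = rule⇔S ⇔-∘ (correct m (n<1+n m) lca' ⇔-∘ positions)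
    where
    positions : Adjacent (toℕ (vertex a)) (toℕ (vertex b)) ⇔ Adjacent a b
    positions = subst₂ (λ x y → Adjacent (toℕ (vertex a)) (toℕ (vertex b)) ⇔ Adjacent x y)
                  (toℕ-vertex 1≤a a≤) (toℕ-vertex 1≤b b≤) (⇔-sym Adjacent-suc⇔)
    colour-at : ∀ {a} → 1 ≤ a → a ≤ size m → toℕ (col (vertex a)) ≡ colour m (suc m) a
    colour-at 1≤a a≤ = trans (toℕ-fromℕ< _) (cong (colour m (suc m)) (toℕ-vertex 1≤a a≤))
    rule⇔S : Rule (colour m (suc m) a) (colour m (suc m) b) ℓ ⇔ (S (col (vertex a)) (col (vertex b)) ℓ ≡ true)
    rule⇔S = ⇔-sym (subst₂ (λ x y → (S (col (vertex a)) (col (vertex b)) ℓ ≡ true) ⇔ Rule x y ℓ)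
                      (colour-at 1≤a a≤) (colour-at 1≤b b≤) (does≡true⇔ (rule? _ _ ℓ)))

  model : TreeModel m (height m) (P N)
  model = record
    { T = tree ; leafPos = leafPos ; leafUnq = leafUnq ; col = col ; S = S ; S-sym = S-sym ; edges = edges }

height≡ : ∀ m → height m ≡ 2 * m + 1
height≡ zero    = refl
height≡ (suc m) = trans (cong (λ h → suc (suc h)) (height≡ m)) (shift m)
  where
  shift : ∀ m → suc (suc (2 * m + 1)) ≡ 2 * suc m + 1
  shift = solve-∀

has-tree-model : ∀ m → 1 ≤ m → P (3 * 2 ^ m ∸ 4) ∈TM[ 2 * m + 1 , m ]
has-tree-model (suc k) 1≤m = subst (λ d → TreeModel (suc k) d (P (3 * 2 ^ suc k ∸ 4))) (height≡ (suc k))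
  (PathModel.model k (3 * 2 ^ suc k ∸ 4) (vertex-count (suc k) 1≤m))

theorem3p7 : (m : ℕ) → 1 ≤ m →
    (P (3 * 2 ^ m ∸ 4) ∈TM[ 2 * m + 1 , m ]) ×
    ((d : ℕ) → ¬ (P (suc (3 * 2 ^ m ∸ 4)) ∈TM[ d , m ]))
theorem3p7 m 1≤m = has-tree-model m 1≤m , no-tree-model m 1≤m
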